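{- Let $s,r\ge1$ be integers and $\phi:\mathfrak o^s\to\mathfrak o^r$ a surjective $\mathfrak o$-linear map. Then there exists $U>0$ such that for all $N>0$ and all $x\in(\mathfrak o_{\le N})^r$, the set $\phi^{ -1}(x)\cap(\mathfrak o_{\le UN})^s$ contains at least $|\mathfrak o_{\le N}|^{s-r}$ elements.
   Context: $\mathcal D$ is a Dedekind domain finitely generated over $\mathbb F_p$, $\mathbb F_q$ the integral closure of $\mathbb F_p$ in $\mathcal D$, $C$ the complete non-singular curve over $\mathbb F_q$ containing $X=\operatorname{Spec}\mathcal D$ as an open subscheme, and $\|\alpha\|=\max_{v\in C\setminus X}q^{ -v(\alpha)\deg v}$ the canonical norm on $\mathcal D$ ($v$ ranging over the closed points at infinity viewed as discrete valuations, $\deg v$ the residue degree over $\mathbb F_q$). The element $t\in\mathcal D$ is fixed so that $\mathcal D$ is finite over $\mathfrak o=\mathbb F_q[t]$ and $\|t\|_v$ is independent of $v\in C\setminus X$. For $N>0$, $\mathfrak o_{\le N}=\{f\in\mathfrak o:\|f\|\le N\}$.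
   Formalization: The bound N ranges over the positive rationals, and the constant U is taken in the rationals. -}

module Defs where

open import Level using (0ℓ)
open import Algebra.Bundles using (CommutativeRing)
open import Data.Bool using (Bool; true; false; _∧_; if_then_else_)
open import Data.Nat as ℕ using (ℕ; zero; suc)
open import Data.Integer using (+_)
open import Data.Fin using (Fin; zero; suc)
open import Data.List using (List; []; _∷_)
open import Data.Product using (Σ; ∃; _×_; _,_)
open import Data.Rational as ℚ using (ℚ; 0ℚ; 1ℚ)
open import Relation.Nullary using (¬_; does)
open import Relation.Binary using (Decidable)
open import Relation.Binary.PropositionalEquality using (_≡_)

record FiniteField (q : ℕ) : Set₁ where
  field
    commRing : CommutativeRing 0ℓ 0ℓ
  open CommutativeRing commRing public
  field
    _≟_             : Decidable _≈_
    1≉0             : ¬ (1# ≈ 0#)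
    inverse         : ∀ x → ¬ (x ≈ 0#) → ∃ λ y → (x * y) ≈ 1#
    enum            : Fin q → Carrier
    enum-injective  : ∀ i j → enum i ≈ enum j → i ≡ j
    enum-surjective : ∀ x → ∃ λ i → enum i ≈ x

-- The polynomial ring 𝔬 = 𝔽_q[t], with the canonical norm ‖f‖ = ‖t‖^(deg f),
-- ‖0‖ = 0, where ‖t‖ = q^k (k ≥ 1, supplied as a parameter).
module PolyOver {q : ℕ} (F : FiniteField q) (k : ℕ) where
  open FiniteField F using (Carrier; _≈_; _+_; _*_; 0#; _≟_)

  -- coefficient lists, lowest degree first: a ∷ f  represents  a + t·f
  Poly : Set
  Poly = List Carrier

  coeff : Poly → ℕ → Carrier
  coeff []      _       = 0#
  coeff (a ∷ f) zero    = a
  coeff (a ∷ f) (suc i) = coeff f i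

  _≈ₚ_ : Poly → Poly → Set
  f ≈ₚ g = ∀ i → coeff f i ≈ coeff g i

  _+ₚ_ : Poly → Poly → Poly
  []      +ₚ g       = g
  (a ∷ f) +ₚ []      = a ∷ f
  (a ∷ f) +ₚ (b ∷ g) = (a + b) ∷ (f +ₚ g)

  scale : Carrier → Poly → Poly
  scale a []      = []
  scale a (b ∷ g) = (a * b) ∷ scale a g

  _*ₚ_ : Poly → Poly → Poly
  []      *ₚ g = []
  (a ∷ f) *ₚ g = scale a g +ₚ (0# ∷ (f *ₚ g))

  isZero : Poly → Bool
  isZero []      = true
  isZero (a ∷ f) = does (a ≟ 0#) ∧ isZero f

  ‖t‖ : ℚ
  ‖t‖ = (+ (q ℕ.^ k)) ℚ./ 1

  ‖_‖ : Poly → ℚ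
  ‖ [] ‖    = 0ℚ
  ‖ a ∷ f ‖ = if isZero f
                then (if does (a ≟ 0#) then 0ℚ else 1ℚ)
                else ‖t‖ ℚ.* ‖ f ‖

  Ball : ℚ → Set
  Ball N = Σ Poly λ f → ‖ f ‖ ℚ.≤ N

  Vecₚ : ℕ → Set
  Vecₚ n = Fin n → Poly

  _≈ᵥ_ : ∀ {n} → Vecₚ n → Vecₚ n → Set
  x ≈ᵥ y = ∀ i → x i ≈ₚ y i

  sumₚ : ∀ {n} → (Fin n → Poly) → Poly
  sumₚ {zero}  f = []
  sumₚ {suc n} f = f zero +ₚ sumₚ (λ i → f (suc i))

  LinMap : ℕ → ℕ → Set
  LinMap s r = Fin r → Fin s → Poly

  apply : ∀ {s r} → LinMap s r → Vecₚ s → Vecₚ r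
  apply φ x i = sumₚ λ j → φ i j *ₚ x j

  Surjective : ∀ {s r} → LinMap s r → Set
  Surjective {s} {r} φ = ∀ (y : Vecₚ r) → ∃ λ (x : Vecₚ s) → apply φ x ≈ᵥ y

{-# OPTIONS --safe #-}
module Submission where

-- Since φ is surjective it has a right inverse ψ over 𝔬 (preimages of the unit vectors), and the
-- constant terms of φψ = I show that ψ(0) has trivial kernel over 𝔽_q.  Gaussian elimination then
-- picks r pivot rows of ψ(0) forming an invertible matrix; the other s − r rows are free.  Put
-- w ∈ 𝔬^(s−r) into the free coordinates (zero at the pivots) to get z, and let
-- lift x w = z + ψ (x − φ z), so that φ (lift x w) = x.  The norm ‖t‖^deg is ultrametric and
-- submultiplicative, hence ‖lift x w‖ ≤ ‖ψ‖ ‖φ‖ N entrywise.  Finally lift x w determines w: at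
-- the pivots it equals ψ_I (x − φ z), and ψ_I is injective on 𝔬^r because its constant term is
-- invertible (compare coefficients degree by degree); so it determines x − φ z, then z, then w.

open import Level using (Level; 0ℓ)
open import Algebra.Bundles using (Ring; CommutativeMonoid)
import Algebra.Properties.CommutativeSemigroup as CommutativeSemigroupProperties
import Algebra.Properties.Semiring.Sum
open import Data.Bool using (true; false)
open import Data.Empty using (⊥-elim)
open import Data.Fin as Fin using (Fin; zero; suc; punchIn; punchOut)
open import Data.Fin.Properties using (any?; punchIn-punchOut; punchInᵢ≢i; punchOut-punchIn; punchOut-cong)
open import Data.Integer as ℤ using (+_)
import Data.Integer.Properties as ℤP
open import Data.List using ([]; _∷_)
open import Data.Nat as ℕ using (ℕ; suc; _∸_)
import Data.Nat.Coprimality as Coprime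
open import Data.Nat.Induction using (<-rec)
import Data.Nat.Properties as ℕP
open import Data.Product using (∃; _,_; proj₁; proj₂)
open import Data.Rational as ℚ using (ℚ; 0ℚ; 1ℚ; _⊔_; NonNegative)
import Data.Rational.Properties as ℚP
open import Data.Sum as Sum using (_⊎_; inj₁; inj₂; [_,_]′)
open import Function using (id; _∘_)
open import Relation.Nullary using (¬_; yes; no; ¬?; does)
open import Relation.Nullary.Decidable using (decidable-stable)
open import Relation.Binary.PropositionalEquality as ≡ using (_≡_)
open import Defs using (FiniteField; module PolyOver)

module MatrixAlgebra {c ℓ : Level} (R : Ring c ℓ) where
  open Ring R hiding (zero)
  open import Algebra.Properties.Ring R using (+-inverseˡ-unique; x∙y⁻¹≈ε⇒x≈y)
  open import Algebra.Properties.Semiring.Sum semiring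
    using (sum; sum-cong-≋; ∑-distrib-+; ∑-comm; *-distribˡ-sum; *-distribʳ-sum; sum-replicate-zero)
  open import Relation.Binary.Reasoning.Setoid setoid

  private variable m n p : ℕ

  Matrix : ℕ → ℕ → Set c
  Matrix m n = Fin m → Fin n → Carrier

  Vector : ℕ → Set c
  Vector n = Fin n → Carrier

  infixr 7 _·ᵥ_
  _·ᵥ_ : Matrix m n → Vector n → Vector m
  (A ·ᵥ x) i = sum λ j → A i j * x j

  column : Matrix m n → Fin n → Vector m
  column A j i = A i j

  sum-zero : {f : Vector n} → (∀ i → f i ≈ 0#) → sum f ≈ 0#
  sum-zero {n} f≈0 = trans (sum-cong-≋ f≈0) (sum-replicate-zero n)

  sum-neg : (f : Vector n) → sum (λ i → - f i) ≈ - sum f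
  sum-neg f = +-inverseˡ-unique _ _ (begin
    sum (λ i → - f i) + sum f  ≈⟨ ∑-distrib-+ (λ i → - f i) f ⟨
    sum (λ i → - f i + f i)    ≈⟨ sum-zero {f = λ i → - f i + f i} (λ i → -‿inverseˡ (f i)) ⟩
    0#                         ∎)

  ·ᵥ-congʳ : (A : Matrix m n) {x y : Vector n} → (∀ j → x j ≈ y j) →
             ∀ i → (A ·ᵥ x) i ≈ (A ·ᵥ y) i
  ·ᵥ-congʳ A x≈y i = sum-cong-≋ λ j → *-congˡ (x≈y j)

  ·ᵥ-zeroʳ : (A : Matrix m n) {x : Vector n} → (∀ j → x j ≈ 0#) → ∀ i → (A ·ᵥ x) i ≈ 0#
  ·ᵥ-zeroʳ A {x} x≈0 i =
    sum-zero {f = λ j → A i j * x j} λ j → trans (*-congˡ (x≈0 j)) (zeroʳ _)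

  ·ᵥ-distrib-+ : (A : Matrix m n) (x y : Vector n) →
                 ∀ i → (A ·ᵥ (λ j → x j + y j)) i ≈ (A ·ᵥ x) i + (A ·ᵥ y) i
  ·ᵥ-distrib-+ A x y i = trans (sum-cong-≋ λ j → distribˡ (A i j) (x j) (y j))
    (∑-distrib-+ (λ j → A i j * x j) (λ j → A i j * y j))

  ·ᵥ-neg : (A : Matrix m n) (x : Vector n) → ∀ i → (A ·ᵥ (λ j → - x j)) i ≈ - (A ·ᵥ x) i
  ·ᵥ-neg A x i = +-inverseˡ-unique _ _ (begin
    (A ·ᵥ (λ j → - x j)) i + (A ·ᵥ x) i  ≈⟨ ·ᵥ-distrib-+ A (λ j → - x j) x i ⟨
    (A ·ᵥ (λ j → - x j + x j)) i         ≈⟨ ·ᵥ-zeroʳ A (λ j → -‿inverseˡ (x j)) i ⟩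
    0#                                   ∎)

  ·ᵥ-assoc : (A : Matrix m n) (B : Matrix n p) (x : Vector p) →
             ∀ i → (A ·ᵥ B ·ᵥ x) i ≈ sum λ l → (A ·ᵥ column B l) i * x l
  ·ᵥ-assoc A B x i = begin
    sum (λ j → A i j * sum λ l → B j l * x l)
      ≈⟨ sum-cong-≋ (λ j → *-distribˡ-sum (A i j) (λ l → B j l * x l)) ⟩
    sum (λ j → sum λ l → A i j * (B j l * x l))
      ≈⟨ ∑-comm (λ j l → A i j * (B j l * x l)) ⟩
    sum (λ l → sum λ j → A i j * (B j l * x l))
      ≈⟨ sum-cong-≋ (λ l → sum-cong-≋ λ j → sym (*-assoc (A i j) (B j l) (x l))) ⟩
    sum (λ l → sum λ j → (A i j * B j l) * x l)
      ≈⟨ sum-cong-≋ (λ l → *-distribʳ-sum (x l) (λ j → A i j * B j l)) ⟨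
    sum (λ l → (A ·ᵥ column B l) i * x l)
      ∎

  δ : Fin n → Fin n → Carrier
  δ zero    zero    = 1#
  δ zero    (suc _) = 0#
  δ (suc _) zero    = 0#
  δ (suc l) (suc i) = δ l i

  sum-δ : (x : Vector n) (i : Fin n) → sum (λ l → δ l i * x l) ≈ x i
  sum-δ x zero = begin
    1# * x zero + sum (λ l → 0# * x (suc l))
      ≈⟨ +-cong (*-identityˡ _) (sum-zero {f = λ l → 0# * x (suc l)} λ l → zeroˡ _) ⟩
    x zero + 0#
      ≈⟨ +-identityʳ _ ⟩
    x zero
      ∎
  sum-δ x (suc i) = begin
    0# * x zero + sum (λ l → δ l i * x (suc l))  ≈⟨ +-cong (zeroˡ _) (sum-δ (λ l → x (suc l)) i) ⟩
    0# + x (suc i)                               ≈⟨ +-identityˡ _ ⟩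
    x (suc i)                                    ∎

  ·ᵥ-δ : (A : Matrix m n) (l : Fin n) → ∀ i → (A ·ᵥ δ l) i ≈ A i l
  ·ᵥ-δ {n = suc n} A zero i = begin
    A i zero * 1# + sum (λ l → A i (suc l) * 0#)
      ≈⟨ +-cong (*-identityʳ _) (sum-zero {f = λ l → A i (suc l) * 0#} λ l → zeroʳ _) ⟩
    A i zero + 0#
      ≈⟨ +-identityʳ _ ⟩
    A i zero
      ∎
  ·ᵥ-δ {n = suc n} A (suc l) i = begin
    A i zero * 0# + ((λ i j → A i (suc j)) ·ᵥ δ l) i
      ≈⟨ +-cong (zeroʳ _) (·ᵥ-δ (λ i j → A i (suc j)) l i) ⟩
    0# + A i (suc l)
      ≈⟨ +-identityˡ _ ⟩
    A i (suc l)
      ∎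

  RightInverse : Matrix m n → Matrix n m → Set ℓ
  RightInverse A B = ∀ l i → (A ·ᵥ column B l) i ≈ δ l i

  rightInverse-·ᵥ : (A : Matrix m n) (B : Matrix n m) → RightInverse A B →
                    (x : Vector m) → ∀ i → (A ·ᵥ B ·ᵥ x) i ≈ x i
  rightInverse-·ᵥ A B AB≈I x i = begin
    (A ·ᵥ B ·ᵥ x) i                      ≈⟨ ·ᵥ-assoc A B x i ⟩
    sum (λ l → (A ·ᵥ column B l) i * x l) ≈⟨ sum-cong-≋ (λ l → *-congʳ (AB≈I l i)) ⟩
    sum (λ l → δ l i * x l)               ≈⟨ sum-δ x i ⟩
    x i                                   ∎

  HasTrivialKernel : Matrix m n → Set (c Level.⊔ ℓ)
  HasTrivialKernel A = ∀ y → (∀ i → (A ·ᵥ y) i ≈ 0#) → ∀ j → y j ≈ 0#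

  trivialKernel⇒injective : (A : Matrix m n) → HasTrivialKernel A →
                            ∀ {x y} → (∀ i → (A ·ᵥ x) i ≈ (A ·ᵥ y) i) → ∀ j → x j ≈ y j
  trivialKernel⇒injective A ker {x} {y} Ax≈Ay j =
    x∙y⁻¹≈ε⇒x≈y (x j) (y j) (ker (λ j → x j - y j) A[x-y]≈0 j)
    where
    A[x-y]≈0 : ∀ i → (A ·ᵥ (λ j → x j - y j)) i ≈ 0#
    A[x-y]≈0 i = begin
      (A ·ᵥ (λ j → x j - y j)) i           ≈⟨ ·ᵥ-distrib-+ A x (λ j → - y j) i ⟩
      (A ·ᵥ x) i + (A ·ᵥ (λ j → - y j)) i  ≈⟨ +-cong (Ax≈Ay i) (·ᵥ-neg A y i) ⟩
      (A ·ᵥ y) i - (A ·ᵥ y) i              ≈⟨ -‿inverseʳ _ ⟩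
      0#                                   ∎

punchIn-elim : ∀ {a n} {P : Fin (suc n) → Set a} (p : Fin (suc n)) →
               P p → (∀ i → P (punchIn p i)) → ∀ j → P j
punchIn-elim {P = P} p Pp Pi j with p Fin.≟ j
... | yes ≡.refl = Pp
... | no p≢j = ≡.subst P (punchIn-punchOut p≢j) (Pi (punchOut p≢j))

module Pivoting {q : ℕ} (F : FiniteField q) where
  open FiniteField F hiding (zero)
  open MatrixAlgebra ring
  open import Algebra.Properties.Ring ring using ([y-z]x≈yx-zx)
  open import Algebra.Properties.Semiring.Sum semiring using (sum; sum-cong-≋; ∑-distrib-+; *-distribˡ-sum)
  open import Algebra.Solver.Ring.NaturalCoefficients.Default commutativeSemiring
    using (solve; _:=_; _:+_; _:*_)
  open import Relation.Binary.Reasoning.Setoid setoid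

  private variable s r : ℕ

  private
    x+y≈0⇒x≈0 : ∀ {x y} → x + y ≈ 0# → y ≈ 0# → x ≈ 0#
    x+y≈0⇒x≈0 {x} {y} x+y≈0 y≈0 = trans (sym (trans (+-congˡ y≈0) (+-identityʳ x))) x+y≈0

    ax≈0⇒x≈0 : ∀ {a b x} → a * b ≈ 1# → a * x ≈ 0# → x ≈ 0#
    ax≈0⇒x≈0 {a} {b} {x} ab≈1 ax≈0 = begin
      x              ≈⟨ *-identityˡ x ⟨
      1# * x         ≈⟨ *-congʳ (trans (*-comm b a) ab≈1) ⟨
      (b * a) * x    ≈⟨ *-assoc b a x ⟩
      b * (a * x)    ≈⟨ *-congˡ ax≈0 ⟩
      b * 0#         ≈⟨ zeroʳ b ⟩
      0#             ∎

  record PivotRows (Ψ : Matrix s r) : Set where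
    field
      pivot               : Fin r → Fin s
      free                : Fin (s ∸ r) → Fin s
      classify            : Fin s → Fin r ⊎ Fin (s ∸ r)
      classify-pivot      : ∀ l → classify (pivot l) ≡ inj₁ l
      classify-free       : ∀ m → classify (free m) ≡ inj₂ m
      pivot-trivialKernel : HasTrivialKernel λ l → Ψ (pivot l)

  nonzero-in-column₀ : (Ψ : Matrix s (suc r)) → HasTrivialKernel Ψ → ∃ λ p → ¬ (Ψ p zero ≈ 0#)
  nonzero-in-column₀ Ψ ker with any? (λ p → ¬? (Ψ p zero ≟ 0#))
  ... | yes found = found
  ... | no none = ⊥-elim (1≉0 (ker (δ zero) column₀≈0 zero))
    where
    column₀≈0 : ∀ j → (Ψ ·ᵥ δ zero) j ≈ 0#
    column₀≈0 j = trans (·ᵥ-δ Ψ zero j)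
      (decidable-stable (Ψ j zero ≟ 0#) λ Ψⱼ₀≉0 → none (j , Ψⱼ₀≉0))

  module RowReduction (Ψ : Matrix (suc s) (suc r)) (p : Fin (suc s)) (Ψₚ₀≉0 : ¬ (Ψ p zero ≈ 0#)) where
    private
      ι : Carrier
      ι = proj₁ (inverse (Ψ p zero) Ψₚ₀≉0)

      Ψₚ₀ι≈1 : Ψ p zero * ι ≈ 1#
      Ψₚ₀ι≈1 = proj₂ (inverse (Ψ p zero) Ψₚ₀≉0)

    multiplier : Vector r
    multiplier l = ι * Ψ p (suc l)

    -- Clear row p using column 0, whose entry Ψ p 0 is invertible; then drop row p and column 0.
    reduced : Matrix s r
    reduced i l = Ψ (punchIn p i) (suc l) - Ψ (punchIn p i) zero * multiplier l

    lead : Vector (suc r) → Carrier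
    lead y = y zero + sum λ l → multiplier l * y (suc l)

    row-pivot : ∀ y → (Ψ ·ᵥ y) p ≈ Ψ p zero * lead y
    row-pivot y = sym (begin
      Ψ p zero * (y zero + S)
        ≈⟨ distribˡ (Ψ p zero) (y zero) S ⟩
      Ψ p zero * y zero + Ψ p zero * S
        ≈⟨ +-congˡ (*-distribˡ-sum (Ψ p zero) λ l → multiplier l * y (suc l)) ⟩
      Ψ p zero * y zero + sum (λ l → Ψ p zero * (multiplier l * y (suc l)))
        ≈⟨ +-congˡ (sum-cong-≋ cancel) ⟩
      (Ψ ·ᵥ y) p
        ∎)
      where
      S = sum λ l → multiplier l * y (suc l)
      cancel : ∀ l → Ψ p zero * (multiplier l * y (suc l)) ≈ Ψ p (suc l) * y (suc l)
      cancel l = begin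
        Ψ p zero * ((ι * Ψ p (suc l)) * y (suc l))
          ≈⟨ solve 4 (λ a i b x → a :* ((i :* b) :* x) := (a :* i) :* (b :* x)) refl
                     (Ψ p zero) ι (Ψ p (suc l)) (y (suc l)) ⟩
        (Ψ p zero * ι) * (Ψ p (suc l) * y (suc l))  ≈⟨ *-congʳ Ψₚ₀ι≈1 ⟩
        1# * (Ψ p (suc l) * y (suc l))              ≈⟨ *-identityˡ _ ⟩
        Ψ p (suc l) * y (suc l)                     ∎

    row-other : ∀ y i → (Ψ ·ᵥ y) (punchIn p i) ≈
                        (reduced ·ᵥ (λ l → y (suc l))) i + Ψ (punchIn p i) zero * lead y
    row-other y i = sym (begin
      (reduced ·ᵥ y′) i + a * (y zero + S)
        ≈⟨ +-cong reduced-row (distribˡ a (y zero) S) ⟩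
      (B - a * S) + (a * y zero + a * S)
        ≈⟨ solve 4 (λ b n z x → (b :+ n) :+ (z :+ x) := (z :+ b) :+ (n :+ x)) refl
                   B (- (a * S)) (a * y zero) (a * S) ⟩
      (a * y zero + B) + (- (a * S) + a * S)
        ≈⟨ +-congˡ (-‿inverseˡ (a * S)) ⟩
      (a * y zero + B) + 0#
        ≈⟨ +-identityʳ _ ⟩
      a * y zero + B
        ∎)
      where
      j = punchIn p i
      a = Ψ j zero
      y′ = λ l → y (suc l)
      B = sum λ l → Ψ j (suc l) * y′ l
      S = sum λ l → multiplier l * y′ l
      reduced-row : (reduced ·ᵥ y′) i ≈ B - a * S
      reduced-row = begin
        sum (λ l → (Ψ j (suc l) - a * multiplier l) * y′ l)
          ≈⟨ sum-cong-≋ (λ l → [y-z]x≈yx-zx (y′ l) (Ψ j (suc l)) (a * multiplier l)) ⟩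
        sum (λ l → Ψ j (suc l) * y′ l - (a * multiplier l) * y′ l)
          ≈⟨ ∑-distrib-+ (λ l → Ψ j (suc l) * y′ l) (λ l → - ((a * multiplier l) * y′ l)) ⟩
        B + sum (λ l → - ((a * multiplier l) * y′ l))
          ≈⟨ +-congˡ (sum-neg λ l → (a * multiplier l) * y′ l) ⟩
        B - sum (λ l → (a * multiplier l) * y′ l)
          ≈⟨ +-congˡ (-‿cong (sum-cong-≋ λ l → *-assoc a (multiplier l) (y′ l))) ⟩
        B - sum (λ l → a * (multiplier l * y′ l))
          ≈⟨ +-congˡ (-‿cong (*-distribˡ-sum a λ l → multiplier l * y′ l)) ⟨
        B - a * S
          ∎

    reduced-trivialKernel : HasTrivialKernel Ψ → HasTrivialKernel reduced
    reduced-trivialKernel ker y′ reducedy′≈0 l = ker y Ψy≈0 (suc l)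
      where
      y : Vector (suc r)
      y zero    = - sum λ l → multiplier l * y′ l
      y (suc l) = y′ l
      a·lead≈0 : ∀ a → a * lead y ≈ 0#
      a·lead≈0 a = trans (*-congˡ (-‿inverseˡ _)) (zeroʳ a)
      Ψy≈0 : ∀ j → (Ψ ·ᵥ y) j ≈ 0#
      Ψy≈0 = punchIn-elim {P = λ j → (Ψ ·ᵥ y) j ≈ 0#} p
        (trans (row-pivot y) (a·lead≈0 _))
        (λ i → trans (row-other y i) (trans (+-cong (reducedy′≈0 i) (a·lead≈0 _)) (+-identityʳ 0#)))

    extend : PivotRows reduced → PivotRows Ψ
    extend P = record
      { pivot               = pivot
      ; free                = λ m → punchIn p (P.free m)
      ; classify            = classify
      ; classify-pivot      = classify-pivot
      ; classify-free       = λ m →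
          ≡.trans (classify-punchIn (P.free m)) (≡.cong (Sum.map₁ suc) (P.classify-free m))
      ; pivot-trivialKernel = pivot-trivialKernel
      }
      where
      module P = PivotRows P

      pivot : Fin (suc r) → Fin (suc s)
      pivot zero    = p
      pivot (suc l) = punchIn p (P.pivot l)

      classify : Fin (suc s) → Fin (suc r) ⊎ Fin (s ∸ r)
      classify j with p Fin.≟ j
      ... | yes _   = inj₁ zero
      ... | no p≢j = Sum.map₁ suc (P.classify (punchOut p≢j))

      classify-punchIn : ∀ i → classify (punchIn p i) ≡ Sum.map₁ suc (P.classify i)
      classify-punchIn i with p Fin.≟ punchIn p i
      ... | yes p≡pᵢ = ⊥-elim (punchInᵢ≢i p i (≡.sym p≡pᵢ))
      ... | no _     =
        ≡.cong (Sum.map₁ suc ∘ P.classify) (≡.trans (punchOut-cong p ≡.refl) (punchOut-punchIn p))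

      classify-pivot : ∀ l → classify (pivot l) ≡ inj₁ l
      classify-pivot zero with p Fin.≟ p
      ... | yes _  = ≡.refl
      ... | no p≢p = ⊥-elim (p≢p ≡.refl)
      classify-pivot (suc l) =
        ≡.trans (classify-punchIn (P.pivot l)) (≡.cong (Sum.map₁ suc) (P.classify-pivot l))

      pivot-trivialKernel : HasTrivialKernel λ l → Ψ (pivot l)
      pivot-trivialKernel y Ψy≈0 = y≈0
        where
        lead≈0 : lead y ≈ 0#
        lead≈0 = ax≈0⇒x≈0 Ψₚ₀ι≈1 (trans (sym (row-pivot y)) (Ψy≈0 zero))
        y′≈0 : ∀ l → y (suc l) ≈ 0#
        y′≈0 = P.pivot-trivialKernel (λ l → y (suc l)) λ l →
          x+y≈0⇒x≈0 (trans (sym (row-other y (P.pivot l))) (Ψy≈0 (suc l)))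
                    (trans (*-congˡ lead≈0) (zeroʳ _))
        y≈0 : ∀ l → y l ≈ 0#
        y≈0 zero    = x+y≈0⇒x≈0 lead≈0
          (sum-zero {f = λ l → multiplier l * y (suc l)} λ l → trans (*-congˡ (y′≈0 l)) (zeroʳ _))
        y≈0 (suc l) = y′≈0 l

  pivotRows : (Ψ : Matrix s r) → HasTrivialKernel Ψ → PivotRows Ψ
  pivotRows {r = ℕ.zero} Ψ ker = record
    { pivot               = λ ()
    ; free                = id
    ; classify            = inj₂
    ; classify-pivot      = λ ()
    ; classify-free       = λ _ → ≡.refl
    ; pivot-trivialKernel = λ _ _ ()
    }
  pivotRows {s} {suc r} Ψ ker with nonzero-in-column₀ Ψ ker
  pivotRows {ℕ.zero}  {suc r} Ψ ker | () , _
  pivotRows {suc s} {suc r} Ψ ker | p , Ψₚ₀≉0 = extend (pivotRows reduced (reduced-trivialKernel ker))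
    where open RowReduction Ψ p Ψₚ₀≉0

module Polynomials {q : ℕ} (F : FiniteField q) (k : ℕ) where
  open FiniteField F hiding (zero)
  open import Data.Nat using (_<_)
  open PolyOver F k
  open import Relation.Binary.Reasoning.Setoid setoid
  open import Algebra.Solver.Ring.NaturalCoefficients.Default commutativeSemiring using (solve; _:=_; _:+_; _:*_)
  open import Algebra.Properties.Semiring.Sum semiring using (sum; sum-cong-≋)

  -ₚ_ : Poly → Poly
  -ₚ f = scale (- 1#) f

  coeff-+ : ∀ f g i → coeff (f +ₚ g) i ≈ coeff f i + coeff g i
  coeff-+ []      g       i       = sym (+-identityˡ _)
  coeff-+ (a ∷ f) []      i       = sym (+-identityʳ _)
  coeff-+ (a ∷ f) (b ∷ g) ℕ.zero  = refl
  coeff-+ (a ∷ f) (b ∷ g) (suc i) = coeff-+ f g i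

  coeff-scale : ∀ a f i → coeff (scale a f) i ≈ a * coeff f i
  coeff-scale a []      i       = sym (zeroʳ a)
  coeff-scale a (b ∷ g) ℕ.zero  = refl
  coeff-scale a (b ∷ g) (suc i) = coeff-scale a g i

  coeff-neg : ∀ f i → coeff (-ₚ f) i ≈ - coeff f i
  coeff-neg f i = trans (coeff-scale (- 1#) f i) (-1*x≈-x _)
    where open import Algebra.Properties.Ring ring using (-1*x≈-x)

  -- A record rather than _≈ₚ_ itself, so that the two polynomials can be inferred from a proof.
  infix 4 _≋_
  record _≋_ (f g : Poly) : Set where
    constructor coeffwise
    field atCoeff : f ≈ₚ g
  open _≋_ public

  ≋-refl : ∀ {f} → f ≋ f
  ≋-refl = coeffwise λ i → refl

  ≋-sym : ∀ {f g} → f ≋ g → g ≋ f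
  ≋-sym f≋g = coeffwise λ i → sym (atCoeff f≋g i)

  ≋-trans : ∀ {f g h} → f ≋ g → g ≋ h → f ≋ h
  ≋-trans f≋g g≋h = coeffwise λ i → trans (atCoeff f≋g i) (atCoeff g≋h i)

  coeff-*-∷ : ∀ a f g i → coeff ((a ∷ f) *ₚ g) i ≈ a * coeff g i + coeff (0# ∷ (f *ₚ g)) i
  coeff-*-∷ a f g i = trans (coeff-+ (scale a g) (0# ∷ (f *ₚ g)) i) (+-congʳ (coeff-scale a g i))

  shift-cong : ∀ {p p′} → p ≋ p′ → (0# ∷ p) ≋ (0# ∷ p′)
  shift-cong p≋p′ = coeffwise λ { ℕ.zero → refl ; (suc i) → atCoeff p≋p′ i }

  shift-zero : ∀ {p} → p ≋ [] → (0# ∷ p) ≋ []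
  shift-zero p≋0 = coeffwise λ { ℕ.zero → refl ; (suc i) → atCoeff p≋0 i }

  shift-+ : ∀ p₁ p₂ i → coeff (0# ∷ (p₁ +ₚ p₂)) i ≈ coeff (0# ∷ p₁) i + coeff (0# ∷ p₂) i
  shift-+ p₁ p₂ ℕ.zero  = sym (+-identityʳ 0#)
  shift-+ p₁ p₂ (suc i) = coeff-+ p₁ p₂ i

  shift-scale : ∀ a p i → coeff (0# ∷ scale a p) i ≈ a * coeff (0# ∷ p) i
  shift-scale a p ℕ.zero  = sym (zeroʳ a)
  shift-scale a p (suc i) = coeff-scale a p i

  +ₚ-cong : ∀ {f f′ g g′} → f ≋ f′ → g ≋ g′ → (f +ₚ g) ≋ (f′ +ₚ g′)
  +ₚ-cong {f} {f′} {g} {g′} f≋f′ g≋g′ = coeffwise λ i →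
    trans (coeff-+ f g i) (trans (+-cong (atCoeff f≋f′ i) (atCoeff g≋g′ i)) (sym (coeff-+ f′ g′ i)))

  +ₚ-assoc : ∀ f g h → ((f +ₚ g) +ₚ h) ≋ (f +ₚ (g +ₚ h))
  +ₚ-assoc f g h = coeffwise λ i → begin
    coeff ((f +ₚ g) +ₚ h) i
      ≈⟨ trans (coeff-+ (f +ₚ g) h i) (+-congʳ (coeff-+ f g i)) ⟩
    (coeff f i + coeff g i) + coeff h i
      ≈⟨ +-assoc _ _ _ ⟩
    coeff f i + (coeff g i + coeff h i)
      ≈⟨ trans (coeff-+ f (g +ₚ h) i) (+-congˡ (coeff-+ g h i)) ⟨
    coeff (f +ₚ (g +ₚ h)) i
      ∎

  +ₚ-comm : ∀ f g → (f +ₚ g) ≋ (g +ₚ f)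
  +ₚ-comm f g = coeffwise λ i → trans (coeff-+ f g i) (trans (+-comm _ _) (sym (coeff-+ g f i)))

  +ₚ-identityʳ : ∀ f → (f +ₚ []) ≋ f
  +ₚ-identityʳ f = coeffwise λ i → trans (coeff-+ f [] i) (+-identityʳ _)

  -ₚ-inverseˡ : ∀ f → ((-ₚ f) +ₚ f) ≋ []
  -ₚ-inverseˡ f = coeffwise λ i →
    trans (coeff-+ (-ₚ f) f i) (trans (+-congʳ (coeff-neg f i)) (-‿inverseˡ _))

  -ₚ-inverseʳ : ∀ f → (f +ₚ (-ₚ f)) ≋ []
  -ₚ-inverseʳ f = ≋-trans (+ₚ-comm f (-ₚ f)) (-ₚ-inverseˡ f)

  -ₚ-cong : ∀ {f g} → f ≋ g → (-ₚ f) ≋ (-ₚ g)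
  -ₚ-cong {f} {g} f≋g = coeffwise λ i →
    trans (coeff-scale (- 1#) f i) (trans (*-congˡ (atCoeff f≋g i)) (sym (coeff-scale (- 1#) g i)))

  *ₚ-zeroˡ : ∀ f g → f ≋ [] → (f *ₚ g) ≋ []
  *ₚ-zeroˡ []      g f≋0 = ≋-refl
  *ₚ-zeroˡ (a ∷ f) g f≋0 = coeffwise λ i → begin
    coeff ((a ∷ f) *ₚ g) i
      ≈⟨ coeff-*-∷ a f g i ⟩
    a * coeff g i + coeff (0# ∷ (f *ₚ g)) i
      ≈⟨ +-cong (trans (*-congʳ a≈0) (zeroˡ _)) (atCoeff (shift-zero (*ₚ-zeroˡ f g tail≋0)) i) ⟩
    0# + 0#
      ≈⟨ +-identityʳ 0# ⟩
    0#
      ∎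
    where
    a≈0 : a ≈ 0#
    a≈0 = atCoeff f≋0 ℕ.zero
    tail≋0 : f ≋ []
    tail≋0 = coeffwise λ j → atCoeff f≋0 (suc j)

  *ₚ-congˡ : ∀ {f f′} g → f ≋ f′ → (f *ₚ g) ≋ (f′ *ₚ g)
  *ₚ-congˡ {[]}    {f′}     g f≋f′ = ≋-sym (*ₚ-zeroˡ f′ g (≋-sym f≋f′))
  *ₚ-congˡ {a ∷ f} {[]}     g f≋f′ = *ₚ-zeroˡ (a ∷ f) g f≋f′
  *ₚ-congˡ {a ∷ f} {b ∷ f′} g f≋f′ = coeffwise λ i → begin
    coeff ((a ∷ f) *ₚ g) i
      ≈⟨ coeff-*-∷ a f g i ⟩
    a * coeff g i + coeff (0# ∷ (f *ₚ g)) i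
      ≈⟨ +-cong (*-congʳ (atCoeff f≋f′ ℕ.zero)) (atCoeff (shift-cong (*ₚ-congˡ g tail≋)) i) ⟩
    b * coeff g i + coeff (0# ∷ (f′ *ₚ g)) i
      ≈⟨ coeff-*-∷ b f′ g i ⟨
    coeff ((b ∷ f′) *ₚ g) i
      ∎
    where
    tail≋ : f ≋ f′
    tail≋ = coeffwise λ j → atCoeff f≋f′ (suc j)

  *ₚ-congʳ : ∀ f {g g′} → g ≋ g′ → (f *ₚ g) ≋ (f *ₚ g′)
  *ₚ-congʳ []      g≋g′ = ≋-refl
  *ₚ-congʳ (a ∷ f) {g} {g′} g≋g′ = coeffwise λ i → begin
    coeff ((a ∷ f) *ₚ g) i
      ≈⟨ coeff-*-∷ a f g i ⟩
    a * coeff g i + coeff (0# ∷ (f *ₚ g)) i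
      ≈⟨ +-cong (*-congˡ (atCoeff g≋g′ i)) (atCoeff (shift-cong (*ₚ-congʳ f g≋g′)) i) ⟩
    a * coeff g′ i + coeff (0# ∷ (f *ₚ g′)) i
      ≈⟨ coeff-*-∷ a f g′ i ⟨
    coeff ((a ∷ f) *ₚ g′) i
      ∎

  *ₚ-cong : ∀ {f f′ g g′} → f ≋ f′ → g ≋ g′ → (f *ₚ g) ≋ (f′ *ₚ g′)
  *ₚ-cong {f′ = f′} {g} f≋f′ g≋g′ = ≋-trans (*ₚ-congˡ g f≋f′) (*ₚ-congʳ f′ g≋g′)

  *ₚ-identityˡ : ∀ g → ((1# ∷ []) *ₚ g) ≋ g
  *ₚ-identityˡ g = coeffwise λ i →
    trans (coeff-*-∷ 1# [] g i)
      (trans (+-cong (*-identityˡ _) (atCoeff (shift-zero ≋-refl) i)) (+-identityʳ _))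

  *ₚ-identityʳ : ∀ f → (f *ₚ (1# ∷ [])) ≋ f
  *ₚ-identityʳ []      = ≋-refl
  *ₚ-identityʳ (a ∷ f) = coeffwise λ
    { ℕ.zero  → trans (+-identityʳ _) (*-identityʳ a)
    ; (suc i) → atCoeff (*ₚ-identityʳ f) i
    }

  *ₚ-distribʳ : ∀ g f f′ → ((f +ₚ f′) *ₚ g) ≋ ((f *ₚ g) +ₚ (f′ *ₚ g))
  *ₚ-distribʳ g []      f′ = ≋-refl
  *ₚ-distribʳ g (a ∷ f) []  = ≋-sym (+ₚ-identityʳ ((a ∷ f) *ₚ g))
  *ₚ-distribʳ g (a ∷ f) (b ∷ f′) = coeffwise λ i → begin
    coeff (((a + b) ∷ (f +ₚ f′)) *ₚ g) i
      ≈⟨ coeff-*-∷ (a + b) (f +ₚ f′) g i ⟩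
    (a + b) * coeff g i + coeff (0# ∷ ((f +ₚ f′) *ₚ g)) i
      ≈⟨ +-congˡ (trans (atCoeff (shift-cong (*ₚ-distribʳ g f f′)) i)
                        (shift-+ (f *ₚ g) (f′ *ₚ g) i)) ⟩
    (a + b) * coeff g i + (coeff (0# ∷ (f *ₚ g)) i + coeff (0# ∷ (f′ *ₚ g)) i)
      ≈⟨ solve 5 (λ a b x y z → (a :+ b) :* x :+ (y :+ z) := (a :* x :+ y) :+ (b :* x :+ z))
                 refl a b (coeff g i) _ _ ⟩
    (a * coeff g i + coeff (0# ∷ (f *ₚ g)) i) + (b * coeff g i + coeff (0# ∷ (f′ *ₚ g)) i)
      ≈⟨ +-cong (coeff-*-∷ a f g i) (coeff-*-∷ b f′ g i) ⟨
    coeff ((a ∷ f) *ₚ g) i + coeff ((b ∷ f′) *ₚ g) i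
      ≈⟨ coeff-+ ((a ∷ f) *ₚ g) ((b ∷ f′) *ₚ g) i ⟨
    coeff (((a ∷ f) *ₚ g) +ₚ ((b ∷ f′) *ₚ g)) i ∎

  *ₚ-distribˡ : ∀ f g g′ → (f *ₚ (g +ₚ g′)) ≋ ((f *ₚ g) +ₚ (f *ₚ g′))
  *ₚ-distribˡ []      g g′ = ≋-refl
  *ₚ-distribˡ (a ∷ f) g g′ = coeffwise λ i → begin
    coeff ((a ∷ f) *ₚ (g +ₚ g′)) i
      ≈⟨ coeff-*-∷ a f (g +ₚ g′) i ⟩
    a * coeff (g +ₚ g′) i + coeff (0# ∷ (f *ₚ (g +ₚ g′))) i
      ≈⟨ +-cong (*-congˡ (coeff-+ g g′ i))
                (trans (atCoeff (shift-cong (*ₚ-distribˡ f g g′)) i) (shift-+ (f *ₚ g) (f *ₚ g′) i)) ⟩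
    a * (coeff g i + coeff g′ i) + (coeff (0# ∷ (f *ₚ g)) i + coeff (0# ∷ (f *ₚ g′)) i)
      ≈⟨ solve 5 (λ a x x′ y z → a :* (x :+ x′) :+ (y :+ z) := (a :* x :+ y) :+ (a :* x′ :+ z))
                 refl a (coeff g i) (coeff g′ i) _ _ ⟩
    (a * coeff g i + coeff (0# ∷ (f *ₚ g)) i) + (a * coeff g′ i + coeff (0# ∷ (f *ₚ g′)) i)
      ≈⟨ +-cong (coeff-*-∷ a f g i) (coeff-*-∷ a f g′ i) ⟨
    coeff ((a ∷ f) *ₚ g) i + coeff ((a ∷ f) *ₚ g′) i
      ≈⟨ coeff-+ ((a ∷ f) *ₚ g) ((a ∷ f) *ₚ g′) i ⟨
    coeff (((a ∷ f) *ₚ g) +ₚ ((a ∷ f) *ₚ g′)) i ∎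

  scale-*ₚ : ∀ a g h → (scale a g *ₚ h) ≋ scale a (g *ₚ h)
  scale-*ₚ a []      h = ≋-refl
  scale-*ₚ a (b ∷ g) h = coeffwise λ i → begin
    coeff (((a * b) ∷ scale a g) *ₚ h) i
      ≈⟨ coeff-*-∷ (a * b) (scale a g) h i ⟩
    (a * b) * coeff h i + coeff (0# ∷ (scale a g *ₚ h)) i
      ≈⟨ +-congˡ (trans (atCoeff (shift-cong (scale-*ₚ a g h)) i) (shift-scale a (g *ₚ h) i)) ⟩
    (a * b) * coeff h i + a * coeff (0# ∷ (g *ₚ h)) i
      ≈⟨ solve 4 (λ a b x y → (a :* b) :* x :+ a :* y := a :* (b :* x :+ y)) refl a b (coeff h i) _ ⟩
    a * (b * coeff h i + coeff (0# ∷ (g *ₚ h)) i)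
      ≈⟨ *-congˡ (coeff-*-∷ b g h i) ⟨
    a * coeff ((b ∷ g) *ₚ h) i
      ≈⟨ coeff-scale a ((b ∷ g) *ₚ h) i ⟨
    coeff (scale a ((b ∷ g) *ₚ h)) i ∎

  shift-*ₚ : ∀ p h → ((0# ∷ p) *ₚ h) ≋ (0# ∷ (p *ₚ h))
  shift-*ₚ p h = coeffwise λ i → trans (coeff-*-∷ 0# p h i) (trans (+-congʳ (zeroˡ _)) (+-identityˡ _))

  *ₚ-assoc : ∀ f g h → ((f *ₚ g) *ₚ h) ≋ (f *ₚ (g *ₚ h))
  *ₚ-assoc []      g h = ≋-refl
  *ₚ-assoc (a ∷ f) g h = ≋-trans (*ₚ-distribʳ h (scale a g) (0# ∷ (f *ₚ g)))
    (+ₚ-cong (scale-*ₚ a g h) (≋-trans (shift-*ₚ (f *ₚ g) h) (shift-cong (*ₚ-assoc f g h))))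

  𝔬 : Ring 0ℓ 0ℓ
  𝔬 = record
    { Carrier = Poly
    ; _≈_     = _≋_
    ; _+_     = _+ₚ_
    ; _*_     = _*ₚ_
    ; -_      = -ₚ_
    ; 0#      = []
    ; 1#      = 1# ∷ []
    ; isRing  = record
      { +-isAbelianGroup = record
        { isGroup = record
          { isMonoid = record
            { isSemigroup = record
              { isMagma = record
                { isEquivalence = record { refl = ≋-refl ; sym = ≋-sym ; trans = ≋-trans }
                ; ∙-cong        = +ₚ-cong
                }
              ; assoc = +ₚ-assoc
              }
            ; identity = (λ f → ≋-refl) , +ₚ-identityʳ
            }
          ; inverse = -ₚ-inverseˡ , -ₚ-inverseʳ
          ; ⁻¹-cong = -ₚ-cong
          }
        ; comm = +ₚ-comm
        }
      ; *-cong     = *ₚ-cong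
      ; *-assoc    = *ₚ-assoc
      ; *-identity = *ₚ-identityˡ , *ₚ-identityʳ
      ; distrib    = *ₚ-distribˡ , *ₚ-distribʳ
      }
    }

  module Σ𝔬 = Algebra.Properties.Semiring.Sum (Ring.semiring 𝔬)
  open MatrixAlgebra 𝔬
  module 𝔽 = MatrixAlgebra ring

  sumₚ≡sum : ∀ {n} (f : Fin n → Poly) → sumₚ f ≡ Σ𝔬.sum f
  sumₚ≡sum {ℕ.zero} f = ≡.refl
  sumₚ≡sum {suc n}  f = ≡.cong (f Fin.zero +ₚ_) (sumₚ≡sum λ l → f (Fin.suc l))

  apply≡·ᵥ : ∀ {s r} (φ : LinMap s r) (x : Vecₚ s) i → apply φ x i ≡ (φ ·ᵥ x) i
  apply≡·ᵥ φ x i = sumₚ≡sum λ j → φ i j *ₚ x j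

  coeff-sum : ∀ {n} (f : Fin n → Poly) i → coeff (Σ𝔬.sum f) i ≈ sum λ l → coeff (f l) i
  coeff-sum {ℕ.zero} f i = refl
  coeff-sum {suc n}  f i = trans (coeff-+ (f Fin.zero) _ i) (+-congˡ (coeff-sum (λ l → f (Fin.suc l)) i))

  coeff-*-lowZero : ∀ f {g m} → (∀ {b} → b < m → coeff g b ≈ 0#) →
                    coeff (f *ₚ g) m ≈ coeff f 0 * coeff g m
  coeff-*-lowZero []      {g} {m}      g<m≈0 = sym (zeroˡ (coeff g m))
  coeff-*-lowZero (a ∷ f) {g} {ℕ.zero} g<m≈0 = trans (coeff-*-∷ a f g 0) (+-identityʳ _)
  coeff-*-lowZero (a ∷ f) {g} {suc m}  g<m≈0 = begin
    coeff ((a ∷ f) *ₚ g) (suc m)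
      ≈⟨ coeff-*-∷ a f g (suc m) ⟩
    a * coeff g (suc m) + coeff (f *ₚ g) m
      ≈⟨ +-congˡ (coeff-*-lowZero f (λ b<m → g<m≈0 (ℕP.m<n⇒m<1+n b<m))) ⟩
    a * coeff g (suc m) + coeff f 0 * coeff g m
      ≈⟨ +-congˡ (trans (*-congˡ (g<m≈0 (ℕP.n<1+n m))) (zeroʳ _)) ⟩
    a * coeff g (suc m) + 0#
      ≈⟨ +-identityʳ _ ⟩
    a * coeff g (suc m)
      ∎

  constantTerms : ∀ {m n} → Matrix m n → 𝔽.Matrix m n
  constantTerms A i j = coeff (A i j) 0

  constantTerm-·ᵥ : ∀ {m n} (A : Matrix m n) (x : Vector n) i →
                    coeff ((A ·ᵥ x) i) 0 ≈ (constantTerms A 𝔽.·ᵥ λ j → coeff (x j) 0) i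
  constantTerm-·ᵥ A x i = trans (coeff-sum (λ j → A i j *ₚ x j) 0)
    (sum-cong-≋ λ j → coeff-*-lowZero (A i j) λ ())

  -- Strong induction on the degree: once every y l vanishes below degree m, the degree-m
  -- coefficients of A y are those of A(0) applied to the degree-m coefficients of y.
  trivialKernel-lift : ∀ {m n} (A : Matrix m n) →
                       𝔽.HasTrivialKernel (constantTerms A) → HasTrivialKernel A
  trivialKernel-lift A ker y Ay≋0 l = coeffwise λ b → <-rec (λ b → ∀ l → coeff (y l) b ≈ 0#) step b l
    where
    step : ∀ m → (∀ {b} → b < m → ∀ l → coeff (y l) b ≈ 0#) → ∀ l → coeff (y l) m ≈ 0#
    step m below = ker (λ l → coeff (y l) m) λ i → begin
      sum (λ l → coeff (A i l) 0 * coeff (y l) m)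
        ≈⟨ sum-cong-≋ (λ l → coeff-*-lowZero (A i l) (λ b<m → below b<m l)) ⟨
      sum (λ l → coeff (A i l *ₚ y l) m)
        ≈⟨ coeff-sum (λ l → A i l *ₚ y l) m ⟨
      coeff ((A ·ᵥ y) i) m
        ≈⟨ atCoeff (Ay≋0 i) m ⟩
      0#
        ∎

  surjective⇒rightInverse : ∀ {s r} (φ : LinMap s r) → Surjective φ → ∃ λ ψ → RightInverse φ ψ
  surjective⇒rightInverse φ surj = (λ j l → proj₁ (surj (δ l)) j) , λ l i →
    ≡.subst (_≋ δ l i) (apply≡·ᵥ φ (proj₁ (surj (δ l))) i) (coeffwise (proj₂ (surj (δ l)) i))

  rightInverse⇒trivialKernel₀ : ∀ {s r} (φ : Matrix r s) (ψ : Matrix s r) →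
                                RightInverse φ ψ → 𝔽.HasTrivialKernel (constantTerms ψ)
  rightInverse⇒trivialKernel₀ φ ψ φψ≈I y Ψ₀y≈0 j = begin
    y j
      ≈⟨ atCoeff (rightInverse-·ᵥ φ ψ φψ≈I v j) 0 ⟨
    coeff ((φ ·ᵥ ψ ·ᵥ v) j) 0
      ≈⟨ constantTerm-·ᵥ φ (ψ ·ᵥ v) j ⟩
    (constantTerms φ 𝔽.·ᵥ (λ l → coeff ((ψ ·ᵥ v) l) 0)) j
      ≈⟨ 𝔽.·ᵥ-zeroʳ (constantTerms φ) (λ l → trans (constantTerm-·ᵥ ψ v l) (Ψ₀y≈0 l)) j ⟩
    0#
      ∎
    where
    v : Vector _
    v l = y l ∷ []

module RationalBounds where
  open import Data.Rational using (_≤_)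

  nonNeg : ∀ {p} → 0ℚ ≤ p → NonNegative p
  nonNeg = ℚ.nonNegative

  0≤1 : 0ℚ ≤ 1ℚ
  0≤1 = ℚP.<⇒≤ (ℚP.positive⁻¹ 1ℚ)

  *-monoˡ-≤ : ∀ {c} → 0ℚ ≤ c → ∀ {x y} → x ≤ y → c ℚ.* x ≤ c ℚ.* y
  *-monoˡ-≤ {c} 0≤c = ℚP.*-monoˡ-≤-nonNeg c {{nonNeg 0≤c}}

  *-monoʳ-≤ : ∀ {c} → 0ℚ ≤ c → ∀ {x y} → x ≤ y → x ℚ.* c ≤ y ℚ.* c
  *-monoʳ-≤ {c} 0≤c = ℚP.*-monoʳ-≤-nonNeg c {{nonNeg 0≤c}}

  *-mono-≤ : ∀ {a b c d} → 0ℚ ≤ b → 0ℚ ≤ c → a ≤ b → c ≤ d → a ℚ.* c ≤ b ℚ.* d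
  *-mono-≤ 0≤b 0≤c a≤b c≤d = ℚP.≤-trans (*-monoʳ-≤ 0≤c a≤b) (*-monoˡ-≤ 0≤b c≤d)

  *-nonNeg : ∀ {a b} → 0ℚ ≤ a → 0ℚ ≤ b → 0ℚ ≤ a ℚ.* b
  *-nonNeg 0≤a 0≤b = ℚP.≤-trans (ℚP.≤-reflexive (≡.sym (ℚP.*-zeroˡ 0ℚ))) (*-mono-≤ 0≤a ℚP.≤-refl 0≤a 0≤b)

  ≤-*ˡ : ∀ {c x} → 1ℚ ≤ c → 0ℚ ≤ x → x ≤ c ℚ.* x
  ≤-*ˡ {c} {x} 1≤c 0≤x = ℚP.≤-trans (ℚP.≤-reflexive (≡.sym (ℚP.*-identityˡ x))) (*-monoʳ-≤ 0≤x 1≤c)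

  *-distribˡ-⊔ : ∀ {c} → 0ℚ ≤ c → ∀ x y → c ℚ.* (x ⊔ y) ≡ c ℚ.* x ⊔ c ℚ.* y
  *-distribˡ-⊔ 0≤c = ℚP.mono-≤-distrib-⊔ (*-monoˡ-≤ 0≤c)

  *-distribʳ-⊔ : ∀ {c} → 0ℚ ≤ c → ∀ x y → (x ⊔ y) ℚ.* c ≡ x ℚ.* c ⊔ y ℚ.* c
  *-distribʳ-⊔ 0≤c = ℚP.mono-≤-distrib-⊔ (*-monoʳ-≤ 0≤c)

  ⨆¹ : ∀ {n} → (Fin n → ℚ) → ℚ
  ⨆¹ {ℕ.zero} f = 1ℚ
  ⨆¹ {suc n}  f = f zero ⊔ ⨆¹ (f ∘ suc)

  1≤⨆¹ : ∀ {n} (f : Fin n → ℚ) → 1ℚ ≤ ⨆¹ f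
  1≤⨆¹ {ℕ.zero} f = ℚP.≤-refl
  1≤⨆¹ {suc n}  f = ℚP.p≤q⇒p≤r⊔q (f zero) (1≤⨆¹ (f ∘ suc))

  ≤⨆¹ : ∀ {n} (f : Fin n → ℚ) i → f i ≤ ⨆¹ f
  ≤⨆¹ f zero    = ℚP.p≤p⊔q (f zero) _
  ≤⨆¹ f (suc i) = ℚP.p≤q⇒p≤r⊔q (f zero) (≤⨆¹ (f ∘ suc) i)

module Norms {q : ℕ} (F : FiniteField q) (k : ℕ) where
  open FiniteField F hiding (zero)
  open import Data.Rational using (_≤_)
  open PolyOver F k
  open Polynomials F k using (𝔬; module Σ𝔬; -ₚ_)
  open MatrixAlgebra 𝔬 using (Matrix; Vector; _·ᵥ_)
  open RationalBounds
  open ℚP.≤-Reasoning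
  open CommutativeSemigroupProperties ℚP.⊔-commutativeSemigroup using (interchange)
  open CommutativeSemigroupProperties (CommutativeMonoid.commutativeSemigroup ℚP.*-1-commutativeMonoid)
    using (x∙yz≈y∙xz)

  private
    inhabited⇒nonZero : ∀ {n} → Fin n → ℕ.NonZero n
    inhabited⇒nonZero Fin.zero    = _
    inhabited⇒nonZero (Fin.suc _) = _

  1≤‖t‖ : 1ℚ ≤ ‖t‖
  1≤‖t‖ = ≡.subst (1ℚ ≤_) (≡.sym (ℚP.normalize-coprime (Coprime.sym (Coprime.1-coprimeTo (q ℕ.^ k)))))
    (ℚ.*≤* (≡.subst (ℤ._≤_ (+ 1)) (≡.sym (ℤP.*-identityʳ (+ (q ℕ.^ k)))) (ℤ.+≤+ (ℕP.m^n>0 q k))))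
    where instance _ = inhabited⇒nonZero (proj₁ (enum-surjective 0#))

  0≤‖t‖ : 0ℚ ≤ ‖t‖
  0≤‖t‖ = ℚP.≤-trans 0≤1 1≤‖t‖

  ‖const‖-nonNeg : ∀ a → 0ℚ ≤ ‖ a ∷ [] ‖
  ‖const‖-nonNeg a with does (a ≟ 0#)
  ... | true  = ℚP.≤-refl
  ... | false = 0≤1

  ‖const‖≤1 : ∀ a → ‖ a ∷ [] ‖ ≤ 1ℚ
  ‖const‖≤1 a with does (a ≟ 0#)
  ... | true  = 0≤1
  ... | false = ℚP.≤-refl

  isZero⇒‖‖≡0 : ∀ f → isZero f ≡ true → ‖ f ‖ ≡ 0ℚ
  isZero⇒‖‖≡0 []      _  = ≡.refl
  isZero⇒‖‖≡0 (a ∷ f) eq with isZero f | does (a ≟ 0#)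
  ... | true | true = ≡.refl

  ¬isZero⇒1≤‖‖ : ∀ f → isZero f ≡ false → 1ℚ ≤ ‖ f ‖
  ¬isZero⇒1≤‖‖ (a ∷ f) eq with isZero f in eqf | does (a ≟ 0#)
  ... | true  | false = ℚP.≤-refl
  ... | false | _     = *-mono-≤ 0≤‖t‖ 0≤1 1≤‖t‖ (¬isZero⇒1≤‖‖ f eqf)

  ‖‖-nonNeg : ∀ f → 0ℚ ≤ ‖ f ‖
  ‖‖-nonNeg f with isZero f in eq
  ... | true  = ℚP.≤-reflexive (≡.sym (isZero⇒‖‖≡0 f eq))
  ... | false = ℚP.≤-trans 0≤1 (¬isZero⇒1≤‖‖ f eq)

  -- The definition of ‖_‖ without its isZero test; the bounds below are inductions on it.
  ‖∷‖ : ∀ a f → ‖ a ∷ f ‖ ≡ ‖t‖ ℚ.* ‖ f ‖ ⊔ ‖ a ∷ [] ‖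
  ‖∷‖ a f with isZero f in eq
  ... | true  = ≡.sym (begin-equality
    ‖t‖ ℚ.* ‖ f ‖ ⊔ ‖ a ∷ [] ‖  ≡⟨ ≡.cong (λ x → ‖t‖ ℚ.* x ⊔ ‖ a ∷ [] ‖) (isZero⇒‖‖≡0 f eq) ⟩
    ‖t‖ ℚ.* 0ℚ ⊔ ‖ a ∷ [] ‖     ≡⟨ ≡.cong (_⊔ ‖ a ∷ [] ‖) (ℚP.*-zeroʳ ‖t‖) ⟩
    0ℚ ⊔ ‖ a ∷ [] ‖             ≡⟨ ℚP.p≤q⇒p⊔q≡q (‖const‖-nonNeg a) ⟩
    ‖ a ∷ [] ‖                  ∎)
  ... | false = ≡.sym (ℚP.p≥q⇒p⊔q≡p (begin
    ‖ a ∷ [] ‖      ≤⟨ ‖const‖≤1 a ⟩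
    1ℚ              ≤⟨ *-mono-≤ 0≤‖t‖ 0≤1 1≤‖t‖ (¬isZero⇒1≤‖‖ f eq) ⟩
    ‖t‖ ℚ.* ‖ f ‖   ∎))

  ‖shift‖ : ∀ h → ‖ 0# ∷ h ‖ ≡ ‖t‖ ℚ.* ‖ h ‖
  ‖shift‖ h = ≡.trans (‖∷‖ 0# h)
    (ℚP.p≥q⇒p⊔q≡p (ℚP.≤-trans (‖const‖≤0 0# refl) (*-nonNeg 0≤‖t‖ (‖‖-nonNeg h))))
    where
    ‖const‖≤0 : ∀ a → a ≈ 0# → ‖ a ∷ [] ‖ ≤ 0ℚ
    ‖const‖≤0 a a≈0 with a ≟ 0#
    ... | yes _   = ℚP.≤-refl
    ... | no a≉0 = ⊥-elim (a≉0 a≈0)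

  ‖const-+‖ : ∀ a b → ‖ (a + b) ∷ [] ‖ ≤ ‖ a ∷ [] ‖ ⊔ ‖ b ∷ [] ‖
  ‖const-+‖ a b with (a + b) ≟ 0#
  ... | yes _ = ℚP.≤-trans (‖const‖-nonNeg a) (ℚP.p≤p⊔q ‖ a ∷ [] ‖ ‖ b ∷ [] ‖)
  ... | no a+b≉0 with a ≟ 0#
  ...   | no _    = ℚP.p≤p⊔q 1ℚ ‖ b ∷ [] ‖
  ...   | yes a≈0 with b ≟ 0#
  ...     | yes b≈0 = ⊥-elim (a+b≉0 (trans (+-cong a≈0 b≈0) (+-identityʳ 0#)))
  ...     | no _    = ℚP.p≤q⊔p 0ℚ 1ℚ

  ‖const-*‖ : ∀ a b → ‖ (a * b) ∷ [] ‖ ≤ ‖ a ∷ [] ‖ ℚ.* ‖ b ∷ [] ‖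
  ‖const-*‖ a b with (a * b) ≟ 0#
  ... | yes _ = *-nonNeg (‖const‖-nonNeg a) (‖const‖-nonNeg b)
  ... | no ab≉0 with a ≟ 0# | b ≟ 0#
  ...   | yes a≈0 | _       = ⊥-elim (ab≉0 (trans (*-congʳ a≈0) (zeroˡ b)))
  ...   | no _    | yes b≈0 = ⊥-elim (ab≉0 (trans (*-congˡ b≈0) (zeroʳ a)))
  ...   | no _    | no _    = ℚP.≤-refl

  ‖+ₚ‖ : ∀ f g → ‖ f +ₚ g ‖ ≤ ‖ f ‖ ⊔ ‖ g ‖
  ‖+ₚ‖ []      g       = ℚP.p≤q⊔p 0ℚ ‖ g ‖
  ‖+ₚ‖ (a ∷ f) []      = ℚP.p≤p⊔q ‖ a ∷ f ‖ 0ℚ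
  ‖+ₚ‖ (a ∷ f) (b ∷ g) = begin
    ‖ (a + b) ∷ (f +ₚ g) ‖
      ≡⟨ ‖∷‖ (a + b) (f +ₚ g) ⟩
    ‖t‖ ℚ.* ‖ f +ₚ g ‖ ⊔ ‖ (a + b) ∷ [] ‖
      ≤⟨ ℚP.⊔-mono-≤ (*-monoˡ-≤ 0≤‖t‖ (‖+ₚ‖ f g)) (‖const-+‖ a b) ⟩
    ‖t‖ ℚ.* (‖ f ‖ ⊔ ‖ g ‖) ⊔ (A ⊔ B)
      ≡⟨ ≡.cong (_⊔ (A ⊔ B)) (*-distribˡ-⊔ 0≤‖t‖ ‖ f ‖ ‖ g ‖) ⟩
    (‖t‖ ℚ.* ‖ f ‖ ⊔ ‖t‖ ℚ.* ‖ g ‖) ⊔ (A ⊔ B)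
      ≡⟨ interchange (‖t‖ ℚ.* ‖ f ‖) (‖t‖ ℚ.* ‖ g ‖) A B ⟩
    (‖t‖ ℚ.* ‖ f ‖ ⊔ A) ⊔ (‖t‖ ℚ.* ‖ g ‖ ⊔ B)
      ≡⟨ ≡.cong₂ _⊔_ (‖∷‖ a f) (‖∷‖ b g) ⟨
    ‖ a ∷ f ‖ ⊔ ‖ b ∷ g ‖
      ∎
    where
    A = ‖ a ∷ [] ‖
    B = ‖ b ∷ [] ‖

  ‖scale‖ : ∀ a g → ‖ scale a g ‖ ≤ ‖ a ∷ [] ‖ ℚ.* ‖ g ‖
  ‖scale‖ a []      = ℚP.≤-reflexive (≡.sym (ℚP.*-zeroʳ ‖ a ∷ [] ‖))
  ‖scale‖ a (b ∷ g) = begin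
    ‖ (a * b) ∷ scale a g ‖
      ≡⟨ ‖∷‖ (a * b) (scale a g) ⟩
    ‖t‖ ℚ.* ‖ scale a g ‖ ⊔ ‖ (a * b) ∷ [] ‖
      ≤⟨ ℚP.⊔-mono-≤ (*-monoˡ-≤ 0≤‖t‖ (‖scale‖ a g)) (‖const-*‖ a b) ⟩
    ‖t‖ ℚ.* (A ℚ.* ‖ g ‖) ⊔ A ℚ.* ‖ b ∷ [] ‖
      ≡⟨ ≡.cong (_⊔ A ℚ.* ‖ b ∷ [] ‖) (x∙yz≈y∙xz ‖t‖ A ‖ g ‖) ⟩
    A ℚ.* (‖t‖ ℚ.* ‖ g ‖) ⊔ A ℚ.* ‖ b ∷ [] ‖
      ≡⟨ *-distribˡ-⊔ (‖const‖-nonNeg a) (‖t‖ ℚ.* ‖ g ‖) ‖ b ∷ [] ‖ ⟨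
    A ℚ.* (‖t‖ ℚ.* ‖ g ‖ ⊔ ‖ b ∷ [] ‖)
      ≡⟨ ≡.cong (A ℚ.*_) (‖∷‖ b g) ⟨
    A ℚ.* ‖ b ∷ g ‖
      ∎
    where A = ‖ a ∷ [] ‖

  ‖*ₚ‖ : ∀ f g → ‖ f *ₚ g ‖ ≤ ‖ f ‖ ℚ.* ‖ g ‖
  ‖*ₚ‖ []      g = ℚP.≤-reflexive (≡.sym (ℚP.*-zeroˡ ‖ g ‖))
  ‖*ₚ‖ (a ∷ f) g = begin
    ‖ scale a g +ₚ (0# ∷ (f *ₚ g)) ‖
      ≤⟨ ‖+ₚ‖ (scale a g) (0# ∷ (f *ₚ g)) ⟩
    ‖ scale a g ‖ ⊔ ‖ 0# ∷ (f *ₚ g) ‖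
      ≡⟨ ≡.cong (‖ scale a g ‖ ⊔_) (‖shift‖ (f *ₚ g)) ⟩
    ‖ scale a g ‖ ⊔ ‖t‖ ℚ.* ‖ f *ₚ g ‖
      ≤⟨ ℚP.⊔-mono-≤ (‖scale‖ a g) (*-monoˡ-≤ 0≤‖t‖ (‖*ₚ‖ f g)) ⟩
    A ℚ.* ‖ g ‖ ⊔ ‖t‖ ℚ.* (‖ f ‖ ℚ.* ‖ g ‖)
      ≡⟨ ≡.cong (A ℚ.* ‖ g ‖ ⊔_) (ℚP.*-assoc ‖t‖ ‖ f ‖ ‖ g ‖) ⟨
    A ℚ.* ‖ g ‖ ⊔ (‖t‖ ℚ.* ‖ f ‖) ℚ.* ‖ g ‖
      ≡⟨ *-distribʳ-⊔ (‖‖-nonNeg g) A (‖t‖ ℚ.* ‖ f ‖) ⟨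
    (A ⊔ ‖t‖ ℚ.* ‖ f ‖) ℚ.* ‖ g ‖
      ≡⟨ ≡.cong (ℚ._* ‖ g ‖) (≡.trans (ℚP.⊔-comm A (‖t‖ ℚ.* ‖ f ‖)) (≡.sym (‖∷‖ a f))) ⟩
    ‖ a ∷ f ‖ ℚ.* ‖ g ‖
      ∎
    where A = ‖ a ∷ [] ‖

  ‖-ₚ‖ : ∀ f → ‖ -ₚ f ‖ ≤ ‖ f ‖
  ‖-ₚ‖ f = begin
    ‖ scale (- 1#) f ‖       ≤⟨ ‖scale‖ (- 1#) f ⟩
    ‖ - 1# ∷ [] ‖ ℚ.* ‖ f ‖  ≤⟨ *-monoʳ-≤ (‖‖-nonNeg f) (‖const‖≤1 (- 1#)) ⟩
    1ℚ ℚ.* ‖ f ‖             ≡⟨ ℚP.*-identityˡ ‖ f ‖ ⟩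
    ‖ f ‖                    ∎

  ‖sum‖≤ : ∀ {n M} (f : Vector n) → 0ℚ ≤ M → (∀ j → ‖ f j ‖ ≤ M) → ‖ Σ𝔬.sum f ‖ ≤ M
  ‖sum‖≤ {ℕ.zero} f 0≤M ‖f‖≤M = 0≤M
  ‖sum‖≤ {suc n}  f 0≤M ‖f‖≤M = ℚP.≤-trans (‖+ₚ‖ (f zero) (Σ𝔬.sum (f ∘ suc)))
    (ℚP.⊔-lub (‖f‖≤M zero) (‖sum‖≤ (f ∘ suc) 0≤M (‖f‖≤M ∘ suc)))

  ‖·ᵥ‖≤ : ∀ {m n C M} (A : Matrix m n) (x : Vector n) → 0ℚ ≤ C → 0ℚ ≤ M →
          (∀ i j → ‖ A i j ‖ ≤ C) → (∀ j → ‖ x j ‖ ≤ M) → ∀ i → ‖ (A ·ᵥ x) i ‖ ≤ C ℚ.* M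
  ‖·ᵥ‖≤ A x 0≤C 0≤M ‖A‖≤C ‖x‖≤M i = ‖sum‖≤ (λ j → A i j *ₚ x j) (*-nonNeg 0≤C 0≤M) λ j →
    ℚP.≤-trans (‖*ₚ‖ (A i j) (x j)) (*-mono-≤ 0≤C (‖‖-nonNeg (x j)) (‖A‖≤C i j) (‖x‖≤M j))

  entryBound : ∀ {m n} → Matrix m n → ℚ
  entryBound A = ⨆¹ λ i → ⨆¹ λ j → ‖ A i j ‖

  1≤entryBound : ∀ {m n} (A : Matrix m n) → 1ℚ ≤ entryBound A
  1≤entryBound A = 1≤⨆¹ λ i → ⨆¹ λ j → ‖ A i j ‖

  ‖entry‖≤entryBound : ∀ {m n} (A : Matrix m n) i j → ‖ A i j ‖ ≤ entryBound A
  ‖entry‖≤entryBound A i j =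
    ℚP.≤-trans (≤⨆¹ (λ j → ‖ A i j ‖) j) (≤⨆¹ (λ i → ⨆¹ λ j → ‖ A i j ‖) i)

module Fibres {q : ℕ} (F : FiniteField q) (k : ℕ) {s r : ℕ}
              (φ : PolyOver.LinMap F k s r) (φ-surjective : PolyOver.Surjective F k φ) where
  open import Data.Rational using (_≤_)
  open PolyOver F k
  open Polynomials F k
  open Norms F k
  open RationalBounds
  open Pivoting F using (PivotRows; pivotRows)
  open MatrixAlgebra 𝔬
  open Ring 𝔬 using (setoid; +-congˡ; +-assoc)
  open import Algebra.Properties.Ring 𝔬 using (+-cancelʳ; xyx⁻¹≈y)

  ψ : Matrix s r
  ψ = proj₁ (surjective⇒rightInverse φ φ-surjective)

  φψ≈I : RightInverse φ ψ
  φψ≈I = proj₂ (surjective⇒rightInverse φ φ-surjective)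

  open PivotRows (pivotRows (constantTerms ψ) (rightInverse⇒trivialKernel₀ φ ψ φψ≈I))

  embed : Vector (s ∸ r) → Vector s
  embed w j = [ (λ _ → []) , w ]′ (classify j)

  correction : Vector r → Vector s → Vector r
  correction x z l = x l +ₚ (-ₚ (φ ·ᵥ z) l)

  lift : Vector r → Vector (s ∸ r) → Vector s
  lift x w j = embed w j +ₚ (ψ ·ᵥ correction x (embed w)) j

  φ-lift : ∀ x w i → (φ ·ᵥ lift x w) i ≋ x i
  φ-lift x w i = begin
    (φ ·ᵥ lift x w) i                 ≈⟨ ·ᵥ-distrib-+ φ z (ψ ·ᵥ correction x z) i ⟩
    φz +ₚ (φ ·ᵥ ψ ·ᵥ correction x z) i ≈⟨ +-congˡ (rightInverse-·ᵥ φ ψ φψ≈I (correction x z) i) ⟩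
    φz +ₚ (x i +ₚ (-ₚ φz))            ≈⟨ +-assoc φz (x i) (-ₚ φz) ⟨
    (φz +ₚ x i) +ₚ (-ₚ φz)            ≈⟨ xyx⁻¹≈y φz (x i) ⟩
    x i                               ∎
    where
    open import Relation.Binary.Reasoning.Setoid setoid
    z = embed w
    φz = (φ ·ᵥ z) i

  apply-lift : ∀ x w → apply φ (lift x w) ≈ᵥ x
  apply-lift x w i = atCoeff (≡.subst (_≋ x i) (≡.sym (apply≡·ᵥ φ (lift x w) i)) (φ-lift x w i))

  ‖embed‖≤ : ∀ {N} w → 0ℚ ≤ N → (∀ m → ‖ w m ‖ ≤ N) → ∀ j → ‖ embed w j ‖ ≤ N
  ‖embed‖≤ w 0≤N ‖w‖≤N j with classify j
  ... | inj₁ _ = 0≤N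
  ... | inj₂ m = ‖w‖≤N m

  liftBound : ℚ
  liftBound = entryBound ψ ℚ.* entryBound φ

  0<liftBound : 0ℚ ℚ.< liftBound
  0<liftBound = ℚP.<-≤-trans (ℚP.positive⁻¹ 1ℚ)
    (*-mono-≤ (ℚP.≤-trans 0≤1 (1≤entryBound ψ)) 0≤1 (1≤entryBound ψ) (1≤entryBound φ))

  ‖lift‖≤ : ∀ {N} x w → 0ℚ ≤ N → (∀ l → ‖ x l ‖ ≤ N) → (∀ m → ‖ w m ‖ ≤ N) →
            ∀ j → ‖ lift x w j ‖ ≤ liftBound ℚ.* N
  ‖lift‖≤ {N} x w 0≤N ‖x‖≤N ‖w‖≤N j = begin
    ‖ z j +ₚ (ψ ·ᵥ u) j ‖           ≤⟨ ‖+ₚ‖ (z j) ((ψ ·ᵥ u) j) ⟩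
    ‖ z j ‖ ⊔ ‖ (ψ ·ᵥ u) j ‖        ≤⟨ ℚP.⊔-lub (ℚP.≤-trans (‖z‖≤N j) (ℚP.≤-trans N≤CN CN≤DCN)) ‖ψu‖≤DCN ⟩
    D ℚ.* (C ℚ.* N)                 ≡⟨ ℚP.*-assoc D C N ⟨
    liftBound ℚ.* N                 ∎
    where
    open ℚP.≤-Reasoning
    C = entryBound φ
    D = entryBound ψ
    z = embed w
    u = correction x z
    0≤C = ℚP.≤-trans 0≤1 (1≤entryBound φ)
    0≤D = ℚP.≤-trans 0≤1 (1≤entryBound ψ)
    ‖z‖≤N = ‖embed‖≤ w 0≤N ‖w‖≤N
    N≤CN : N ≤ C ℚ.* N
    N≤CN = ≤-*ˡ (1≤entryBound φ) 0≤N
    CN≤DCN : C ℚ.* N ≤ D ℚ.* (C ℚ.* N)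
    CN≤DCN = ≤-*ˡ (1≤entryBound ψ) (*-nonNeg 0≤C 0≤N)
    ‖u‖≤CN : ∀ l → ‖ u l ‖ ≤ C ℚ.* N
    ‖u‖≤CN l = ℚP.≤-trans (‖+ₚ‖ (x l) (-ₚ (φ ·ᵥ z) l)) (ℚP.⊔-lub (ℚP.≤-trans (‖x‖≤N l) N≤CN)
      (ℚP.≤-trans (‖-ₚ‖ ((φ ·ᵥ z) l)) (‖·ᵥ‖≤ φ z 0≤C 0≤N (‖entry‖≤entryBound φ) ‖z‖≤N l)))
    ‖ψu‖≤DCN : ‖ (ψ ·ᵥ u) j ‖ ≤ D ℚ.* (C ℚ.* N)
    ‖ψu‖≤DCN = ‖·ᵥ‖≤ ψ u 0≤D (*-nonNeg 0≤C 0≤N) (‖entry‖≤entryBound ψ) ‖u‖≤CN j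

  lift-injective : ∀ x w w′ → (∀ j → lift x w j ≋ lift x w′ j) → ∀ m → w m ≋ w′ m
  lift-injective x w w′ lift≋ m = ≡.subst₂ _≋_ (embed-free w) (embed-free w′) (embed≋ (free m))
    where
    open import Relation.Binary.Reasoning.Setoid setoid
    u = correction x (embed w)
    u′ = correction x (embed w′)
    embed-pivot : ∀ w l → embed w (pivot l) ≡ []
    embed-pivot w l = ≡.cong [ (λ _ → []) , w ]′ (classify-pivot l)
    embed-free : ∀ w → embed w (free m) ≡ w m
    embed-free w = ≡.cong [ (λ _ → []) , w ]′ (classify-free m)
    ψu≋ψu′-at-pivots : ∀ l → (ψ ·ᵥ u) (pivot l) ≋ (ψ ·ᵥ u′) (pivot l)
    ψu≋ψu′-at-pivots l = ≡.subst₂ (λ a b → (a +ₚ (ψ ·ᵥ u) (pivot l)) ≋ (b +ₚ (ψ ·ᵥ u′) (pivot l)))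
      (embed-pivot w l) (embed-pivot w′ l) (lift≋ (pivot l))
    u≋u′ : ∀ l → u l ≋ u′ l
    u≋u′ = trivialKernel⇒injective (λ l → ψ (pivot l))
      (trivialKernel-lift (λ l → ψ (pivot l)) pivot-trivialKernel) ψu≋ψu′-at-pivots
    embed≋ : ∀ j → embed w j ≋ embed w′ j
    embed≋ j = +-cancelʳ ((ψ ·ᵥ u) j) (embed w j) (embed w′ j) (begin
      embed w j +ₚ (ψ ·ᵥ u) j    ≈⟨ lift≋ j ⟩
      embed w′ j +ₚ (ψ ·ᵥ u′) j  ≈⟨ +-congˡ (·ᵥ-congʳ ψ (λ l → ≋-sym (u≋u′ l)) j) ⟩
      embed w′ j +ₚ (ψ ·ᵥ u) j   ∎)

open import Data.Nat using (_≤_)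
open import Data.Product using (_×_)
open import Data.Rational using (_<_; _*_)
import Data.Rational

lemma2p7 : ∀ {q : ℕ} (F : FiniteField q) (k : ℕ) → 1 ≤ k →
    let open PolyOver F k in
    (s r : ℕ) → 1 ≤ s → 1 ≤ r → (φ : LinMap s r) → Surjective φ →
    ∃ λ (U : ℚ) → 0ℚ < U ×
      (∀ (N : ℚ) → 0ℚ < N → (x : Vecₚ r) → (∀ i → ‖ x i ‖ Data.Rational.≤ N) →
        ∃ λ (g : (Fin (s ∸ r) → Ball N) → Vecₚ s) →
          (∀ w → apply φ (g w) ≈ᵥ x) ×
          (∀ w j → ‖ g w j ‖ Data.Rational.≤ U * N) ×
          (∀ w w′ → g w ≈ᵥ g w′ → ∀ i → proj₁ (w i) ≈ₚ proj₁ (w′ i)))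
lemma2p7 F k _ s r _ _ φ φ-surjective = liftBound , 0<liftBound , λ N 0<N x ‖x‖≤N →
    (λ w → lift x (proj₁ ∘ w))
  , (λ w → apply-lift x (proj₁ ∘ w))
  , (λ w → ‖lift‖≤ x (proj₁ ∘ w) (ℚP.<⇒≤ 0<N) ‖x‖≤N (proj₂ ∘ w))
  , (λ w w′ g≈g′ m → atCoeff (lift-injective x (proj₁ ∘ w) (proj₁ ∘ w′) (coeffwise ∘ g≈g′) m))
  where
  open Polynomials F k using (atCoeff; coeffwise)
  open Fibres F k φ φ-surjective
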